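{- Let $q$ be a positive integer and $S\subseteq[q]^2$ nonempty with $V_x(S)+V_y(S)\le|S|^{1.5}$. Let $c$ be a positive integer. Pick $S_x,S_y\subseteq[q]^c$ independently and uniformly at random among subsets of given sizes $|S_x|,|S_y|\ge q^c/\sqrt{|S|^c}$. Then $$\Pr\big[|(S_x\times S_y)\cap S^{\otimes c}|>0\big]\ge 1/4.$$
   Context: For $S\subseteq[q]^2$, $V_x(S)=\sum_{i\in[q]}|\{j:(i,j)\in S\}|^2$ and $V_y(S)=\sum_{j\in[q]}|\{i:(i,j)\in S\}|^2$. The set $S^{\otimes c}\subseteq([q]^c)^2$ is $$\{((i_1,\dots,i_c),(j_1,\dots,j_c)) : (i_\ell,j_\ell)\in S\text{ for all }\ell\in[c]\},$$ where $[q]^c$ is identified with $[q^c]$. -}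

module Defs where

open import Data.Nat using (ℕ; zero; suc; _+_; _*_; _^_; _≡ᵇ_)
open import Data.Bool using (Bool; true; false; _∧_; if_then_else_)
open import Data.Fin using (Fin; zero; suc; remQuot)
open import Data.Fin.Subset using (Subset; ∣_∣)
open import Data.Vec using (Vec; []; _∷_; lookup)
open import Data.List using (List; []; _∷_; _++_; map; length; filter; allFin; concatMap)
open import Data.Nat.ListAction using (sum)
open import Data.Bool.ListAction using (all; any)
open import Data.Product using (_×_; _,_; proj₁; proj₂)

Rel2 : ℕ → Set
Rel2 q = Fin q → Fin q → Bool

count : ∀ {n} → (Fin n → Bool) → ℕ
count {n} p = sum (map (λ i → if p i then 1 else 0) (allFin n))

countL : ∀ {A : Set} → (A → Bool) → List A → ℕ
countL p xs = sum (map (λ x → if p x then 1 else 0) xs)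

card : ∀ {q} → Rel2 q → ℕ
card {q} S = sum (map (λ i → count (S i)) (allFin q))

Vx : ∀ {q} → Rel2 q → ℕ
Vx {q} S = sum (map (λ i → count (S i) * count (S i)) (allFin q))

Vy : ∀ {q} → Rel2 q → ℕ
Vy {q} S = sum (map (λ j → count (λ i → S i j) * count (λ i → S i j)) (allFin q))

-- Identification [q^c] ≅ [q]^c (mixed-radix digits; coordinate 0 is the most significant)
decode : ∀ {q} c → Fin (q ^ c) → (Fin c → Fin q)
decode {q} zero x ()
decode {q} (suc c) x zero = proj₁ (remQuot {q} (q ^ c) x)
decode {q} (suc c) x (suc l) = decode c (proj₂ (remQuot {q} (q ^ c) x)) l

tensorPow : ∀ {q} → Rel2 q → (c : ℕ) → Rel2 (q ^ c)
tensorPow {q} S c x y = all (λ l → S (decode c x l) (decode c y l)) (allFin c)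

allSubsets : ∀ n → List (Subset n)
allSubsets zero = [] ∷ []
allSubsets (suc n) = concatMap (λ s → (true ∷ s) ∷ (false ∷ s) ∷ []) (allSubsets n)

subsetsOfSize : ∀ n → ℕ → List (Subset n)
subsetsOfSize n k = filter (λ s → Data.Bool._≟_ (∣ s ∣ ≡ᵇ k) true) (allSubsets n)
  where import Data.Bool

pairs : ∀ {A B : Set} → List A → List B → List (A × B)
pairs xs ys = concatMap (λ x → map (λ y → (x , y)) ys) xs

meets : ∀ {N} → Rel2 N → Subset N → Subset N → Bool
meets {N} T A B =
  any (λ x → any (λ y → lookup A x ∧ lookup B y ∧ T x y) (allFin N)) (allFin N)

{-# OPTIONS --safe #-}
-- The second moment method. With N = q ^ c and T = S^{⊗c} one has |T| = |S|^c,
-- V_x(T) = V_x(S)^c and V_y(T) = V_y(S)^c, so the hypotheses become N·V_x(T) ≤ |T|²a,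
-- N·V_y(T) ≤ |T|²b and N² ≤ |T|ab. Let X(A,B) = |(A × B) ∩ T| for A, B of sizes a, b, and let M
-- be the number of such pairs. Every point lies in C(N-1,a-1) sets A and every two distinct points
-- in C(N-2,a-2), so ∑X = C(N-1,a-1)·C(N-1,b-1)·|T|, while ∑X² splits into four terms governed by
-- |T|², V_y(T), V_x(T) and |T|; the hypotheses bound each of them, giving M·∑X² ≤ 4(∑X)².
-- Cauchy–Schwarz, (∑X)² ≤ #{X > 0}·∑X², then yields #{X > 0} ≥ M/4.
module Submission where

open import Defs
open import Data.Nat using (ℕ; zero; suc; _+_; _*_; _∸_; _^_; _≤_; _<_; _≤?_; _≡ᵇ_; z≤n; s≤s)
open import Data.Nat.Properties
open import Data.Nat.ListAction using (sum)
open import Data.Nat.Tactic.RingSolver using (solve-∀)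
open import Data.Bool using (Bool; true; false; _∧_; if_then_else_)
import Data.Bool
open import Data.Bool.ListAction using (and; any)
open import Data.Empty using (⊥-elim)
open import Data.Fin using (Fin; zero; suc; _↑ˡ_; _↑ʳ_; combine; remQuot)
import Data.Fin
open import Data.Fin.Properties using (remQuot-combine)
open import Data.Fin.Subset using (Subset; ∣_∣)
open import Data.List using (List; []; _∷_; _++_; map; concatMap; filter; allFin; length)
open import Data.List.Properties using (map-tabulate)
open import Data.Product using (_×_; _,_; proj₁; proj₂)
open import Data.Sum using (inj₁; inj₂)
open import Data.Vec using (_∷_; lookup)
open import Function using (_∘_; id)
open import Relation.Binary.PropositionalEquality
open import Relation.Nullary using (does; yes; no; contradiction)
open import Algebra.Properties.CommutativeSemigroup +-commutativeSemigroup
  using () renaming (interchange to +-interchange)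
open import Algebra.Properties.CommutativeSemigroup *-commutativeSemigroup
  using () renaming (interchange to *-interchange; x∙yz≈y∙xz to *-left-comm)

-- Finite sums

⟦_⟧ : Bool → ℕ
⟦ b ⟧ = if b then 1 else 0

⟦∧⟧ : ∀ a b → ⟦ a ∧ b ⟧ ≡ ⟦ a ⟧ * ⟦ b ⟧
⟦∧⟧ true b = sym (+-identityʳ _)
⟦∧⟧ false b = refl

⟦⟧-idem : ∀ a → ⟦ a ⟧ * ⟦ a ⟧ ≡ ⟦ a ⟧
⟦⟧-idem true = refl
⟦⟧-idem false = refl

⟦⟧≤1 : ∀ a → ⟦ a ⟧ ≤ 1
⟦⟧≤1 true = s≤s z≤n
⟦⟧≤1 false = z≤n

∑ : ∀ {A : Set} → List A → (A → ℕ) → ℕ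
∑ xs f = sum (map f xs)

syntax ∑ xs (λ x → e) = ∑[ x ∈ xs ] e

module _ {A : Set} where

  ∑-cong : (xs : List A) {f g : A → ℕ} → (∀ x → f x ≡ g x) → ∑ xs f ≡ ∑ xs g
  ∑-cong [] e = refl
  ∑-cong (x ∷ xs) e = cong₂ _+_ (e x) (∑-cong xs e)

  ∑-mono : (xs : List A) {f g : A → ℕ} → (∀ x → f x ≤ g x) → ∑ xs f ≤ ∑ xs g
  ∑-mono [] e = z≤n
  ∑-mono (x ∷ xs) e = +-mono-≤ (e x) (∑-mono xs e)

  ∑-zero : (xs : List A) → ∑[ _ ∈ xs ] 0 ≡ 0
  ∑-zero [] = refl
  ∑-zero (x ∷ xs) = ∑-zero xs

  ∑-one : (xs : List A) → ∑[ _ ∈ xs ] 1 ≡ length xs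
  ∑-one [] = refl
  ∑-one (x ∷ xs) = cong suc (∑-one xs)

  ∑-+ : (xs : List A) (f g : A → ℕ) → ∑[ x ∈ xs ] (f x + g x) ≡ ∑ xs f + ∑ xs g
  ∑-+ [] f g = refl
  ∑-+ (x ∷ xs) f g =
    trans (cong (f x + g x +_) (∑-+ xs f g)) (+-interchange (f x) (g x) (∑ xs f) (∑ xs g))

  ∑-*ˡ : (xs : List A) (c : ℕ) (f : A → ℕ) → ∑[ x ∈ xs ] (c * f x) ≡ c * ∑ xs f
  ∑-*ˡ [] c f = sym (*-zeroʳ c)
  ∑-*ˡ (x ∷ xs) c f = trans (cong (c * f x +_) (∑-*ˡ xs c f)) (sym (*-distribˡ-+ c (f x) _))

  ∑-*ʳ : (xs : List A) (c : ℕ) (f : A → ℕ) → ∑[ x ∈ xs ] (f x * c) ≡ ∑ xs f * c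
  ∑-*ʳ xs c f = trans (∑-cong xs (λ x → *-comm (f x) c)) (trans (∑-*ˡ xs c f) (*-comm c _))

  ∑-linear : (xs : List A) (a b : ℕ) (f g : A → ℕ) →
             ∑[ x ∈ xs ] (a * f x + b * g x) ≡ a * ∑ xs f + b * ∑ xs g
  ∑-linear xs a b f g =
    trans (∑-+ xs (λ x → a * f x) (λ x → b * g x)) (cong₂ _+_ (∑-*ˡ xs a f) (∑-*ˡ xs b g))

  ∑-++ : (xs ys : List A) (f : A → ℕ) → ∑ (xs ++ ys) f ≡ ∑ xs f + ∑ ys f
  ∑-++ [] ys f = refl
  ∑-++ (x ∷ xs) ys f = trans (cong (f x +_) (∑-++ xs ys f)) (sym (+-assoc (f x) _ _))

  ∑-filter : (p : A → Bool) (xs : List A) (f : A → ℕ) →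
             ∑ (filter (λ x → p x Data.Bool.≟ true) xs) f ≡ ∑[ x ∈ xs ] (⟦ p x ⟧ * f x)
  ∑-filter p [] f = refl
  ∑-filter p (x ∷ xs) f with p x
  ... | true  = cong₂ _+_ (sym (+-identityʳ (f x))) (∑-filter p xs f)
  ... | false = ∑-filter p xs f

  ∑-≤-length : (p : A → Bool) (xs : List A) →
               ∑[ x ∈ xs ] ⟦ p x ⟧ ≤ length xs * ⟦ any p xs ⟧
  ∑-≤-length p [] = z≤n
  ∑-≤-length p (x ∷ xs) with p x
  ... | true  = s≤s (begin
    ∑[ y ∈ xs ] ⟦ p y ⟧ ≤⟨ ∑-mono xs (λ y → ⟦⟧≤1 (p y)) ⟩
    ∑[ y ∈ xs ] 1        ≡⟨ ∑-one xs ⟩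
    length xs            ≡⟨ *-identityʳ _ ⟨
    length xs * 1        ∎)
    where open ≤-Reasoning
  ... | false = ≤-trans (∑-≤-length p xs) (m≤n+m _ _)

module _ {A B : Set} where

  ∑-map : (xs : List A) (h : A → B) (f : B → ℕ) → ∑ (map h xs) f ≡ ∑ xs (f ∘ h)
  ∑-map [] h f = refl
  ∑-map (x ∷ xs) h f = cong (f (h x) +_) (∑-map xs h f)

  ∑-concatMap : (xs : List A) (h : A → List B) (f : B → ℕ) →
                ∑ (concatMap h xs) f ≡ ∑[ x ∈ xs ] ∑ (h x) f
  ∑-concatMap [] h f = refl
  ∑-concatMap (x ∷ xs) h f =
    trans (∑-++ (h x) (concatMap h xs) f) (cong (∑ (h x) f +_) (∑-concatMap xs h f))

  ∑-comm : (xs : List A) (ys : List B) (f : A → B → ℕ) →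
           ∑[ x ∈ xs ] ∑[ y ∈ ys ] f x y ≡ ∑[ y ∈ ys ] ∑[ x ∈ xs ] f x y
  ∑-comm [] ys f = sym (∑-zero ys)
  ∑-comm (x ∷ xs) ys f =
    trans (cong (∑ ys (f x) +_) (∑-comm xs ys f)) (sym (∑-+ ys (f x) _))

  ∑-*-∑ : (xs : List A) (ys : List B) (f : A → ℕ) (g : B → ℕ) →
          ∑ xs f * ∑ ys g ≡ ∑[ x ∈ xs ] ∑[ y ∈ ys ] (f x * g y)
  ∑-*-∑ xs ys f g = trans (sym (∑-*ʳ xs _ f)) (∑-cong xs (λ x → sym (∑-*ˡ ys (f x) g)))

∑-pairs : ∀ {A B : Set} (xs : List A) (ys : List B) (f : A × B → ℕ) →
          ∑ (pairs xs ys) f ≡ ∑[ x ∈ xs ] ∑[ y ∈ ys ] f (x , y)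
∑-pairs xs ys f = trans (∑-concatMap xs _ f) (∑-cong xs (λ x → ∑-map ys (x ,_) f))

module _ {A B : Set} (xs : List A) (ys : List B) where

  ∑∑-comm-∑ : ∀ {C : Set} (zs : List C) (f : A → B → C → ℕ) →
              ∑[ x ∈ xs ] ∑[ y ∈ ys ] ∑[ z ∈ zs ] f x y z
                ≡ ∑[ z ∈ zs ] ∑[ x ∈ xs ] ∑[ y ∈ ys ] f x y z
  ∑∑-comm-∑ zs f = trans (∑-cong xs (λ x → ∑-comm ys zs (f x))) (∑-comm xs zs _)

  ∑∑-separate : (f : A → ℕ) (g : B → ℕ) (w : ℕ) →
                ∑[ x ∈ xs ] ∑[ y ∈ ys ] (f x * (g y * w)) ≡ ∑ xs f * (∑ ys g * w)
  ∑∑-separate f g w = trans (∑-cong xs (λ x → trans (∑-*ˡ ys (f x) (λ y → g y * w))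
                                                     (cong (f x *_) (∑-*ʳ ys w g))))
                            (∑-*ʳ xs _ f)

∑< : ∀ n → (Fin n → ℕ) → ℕ
∑< n = ∑ (allFin n)

syntax ∑< n (λ i → e) = ∑[ i < n ] e

∑<-suc : ∀ n (f : Fin (suc n) → ℕ) → ∑< (suc n) f ≡ f zero + ∑< n (f ∘ suc)
∑<-suc n f = cong (λ xs → f zero + sum xs)
  (trans (map-tabulate suc f) (sym (map-tabulate id (f ∘ suc))))

∑<-+ : ∀ m n (f : Fin (m + n) → ℕ) → ∑< (m + n) f ≡ ∑[ i < m ] f (i ↑ˡ n) + ∑[ j < n ] f (m ↑ʳ j)
∑<-+ zero n f = refl
∑<-+ (suc m) n f = begin
  ∑< (suc m + n) f
    ≡⟨ ∑<-suc (m + n) f ⟩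
  f zero + ∑< (m + n) (f ∘ suc)
    ≡⟨ cong (f zero +_) (∑<-+ m n (f ∘ suc)) ⟩
  f zero + (∑[ i < m ] f (suc (i ↑ˡ n)) + ∑[ j < n ] f (suc (m ↑ʳ j)))
    ≡⟨ +-assoc (f zero) _ _ ⟨
  f zero + ∑[ i < m ] f (suc (i ↑ˡ n)) + ∑[ j < n ] f (suc m ↑ʳ j)
    ≡⟨ cong (_+ ∑[ j < n ] f (suc m ↑ʳ j)) (∑<-suc m (λ i → f (i ↑ˡ n))) ⟨
  ∑[ i < suc m ] f (i ↑ˡ n) + ∑[ j < n ] f (suc m ↑ʳ j) ∎
  where open ≡-Reasoning

∑<-combine : ∀ m n (f : Fin (m * n) → ℕ) → ∑< (m * n) f ≡ ∑[ i < m ] ∑[ j < n ] f (combine i j)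
∑<-combine zero n f = refl
∑<-combine (suc m) n f = begin
  ∑< (n + m * n) f
    ≡⟨ ∑<-+ n (m * n) f ⟩
  ∑[ j < n ] f (j ↑ˡ (m * n)) + ∑[ k < m * n ] f (n ↑ʳ k)
    ≡⟨ cong (∑[ j < n ] f (j ↑ˡ (m * n)) +_) (∑<-combine m n (λ k → f (n ↑ʳ k))) ⟩
  ∑[ j < n ] f (combine {suc m} zero j) + ∑[ i < m ] ∑[ j < n ] f (combine (suc i) j)
    ≡⟨ ∑<-suc m _ ⟨
  ∑[ i < suc m ] ∑[ j < n ] f (combine i j) ∎
  where open ≡-Reasoning

δ : ∀ {n} → Fin n → Fin n → ℕ
δ i j = ⟦ does (i Data.Fin.≟ j) ⟧

∑<-δ : ∀ n (i : Fin n) (g : Fin n → ℕ) → ∑[ j < n ] (δ i j * g j) ≡ g i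
∑<-δ (suc n) zero g = begin
  ∑[ j < suc n ] (δ zero j * g j)      ≡⟨ ∑<-suc n _ ⟩
  g zero + 0 + ∑[ j < n ] 0           ≡⟨ cong (g zero + 0 +_) (∑-zero (allFin n)) ⟩
  g zero + 0 + 0                      ≡⟨ trans (+-identityʳ _) (+-identityʳ _) ⟩
  g zero                              ∎
  where open ≡-Reasoning
∑<-δ (suc n) (suc i) g = begin
  ∑[ j < suc n ] (δ (suc i) j * g j)    ≡⟨ ∑<-suc n (λ j → δ (suc i) j * g j) ⟩
  ∑[ j < n ] (δ (suc i) (suc j) * g (suc j)) ≡⟨ ∑-cong (allFin n) δ-suc ⟩
  ∑[ j < n ] (δ i j * g (suc j))       ≡⟨ ∑<-δ n i (g ∘ suc) ⟩
  g (suc i)                           ∎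
  where
  open ≡-Reasoning
  δ-suc : ∀ j → δ (suc i) (suc j) * g (suc j) ≡ δ i j * g (suc j)
  δ-suc j with i Data.Fin.≟ j
  ... | yes _ = refl
  ... | no _ = refl

∑<-affine-δ : ∀ n a b (i : Fin n) (f : Fin n → ℕ) →
              ∑[ j < n ] ((a + δ i j * b) * f j) ≡ a * ∑< n f + b * f i
∑<-affine-δ n a b i f = begin
  ∑[ j < n ] ((a + δ i j * b) * f j)        ≡⟨ ∑-cong (allFin n) (λ j → distribute a (δ i j) b (f j)) ⟩
  ∑[ j < n ] (a * f j + b * (δ i j * f j))  ≡⟨ ∑-linear (allFin n) a b f (λ j → δ i j * f j) ⟩
  a * ∑< n f + b * ∑[ j < n ] (δ i j * f j) ≡⟨ cong (λ t → a * ∑< n f + b * t) (∑<-δ n i f) ⟩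
  a * ∑< n f + b * f i                      ∎
  where
  open ≡-Reasoning
  distribute : ∀ a d b x → (a + d * b) * x ≡ a * x + b * (d * x)
  distribute = solve-∀

∑<-combine-* : ∀ m n (f : Fin (m * n) → ℕ) (g : Fin m → ℕ) (h : Fin n → ℕ) →
  (∀ i j → f (combine i j) ≡ g i * h j) → ∑< (m * n) f ≡ ∑< m g * ∑< n h
∑<-combine-* m n f g h f≡gh = begin
  ∑< (m * n) f                          ≡⟨ ∑<-combine m n f ⟩
  ∑[ i < m ] ∑[ j < n ] f (combine i j) ≡⟨ ∑-cong (allFin m) (λ i → ∑-cong (allFin n) (f≡gh i)) ⟩
  ∑[ i < m ] ∑[ j < n ] (g i * h j)     ≡⟨ ∑-*-∑ (allFin m) (allFin n) g h ⟨
  ∑< m g * ∑< n h                       ∎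
  where open ≡-Reasoning

-- Binomial coefficients and sums over the subsets of a given size

choose : ℕ → ℕ → ℕ
choose n zero = 1
choose zero (suc k) = 0
choose (suc n) (suc k) = choose n k + choose n (suc k)

-- C(n, k ∸ 1) and C(n, k ∸ 2), read as 0 when k is too small.
chooseMinus₁ chooseMinus₂ : ℕ → ℕ → ℕ
chooseMinus₁ n zero = 0
chooseMinus₁ n (suc k) = choose n k
chooseMinus₂ n zero = 0
chooseMinus₂ n (suc k) = chooseMinus₁ n k

chooseMinus₁-pascal : ∀ n k → chooseMinus₁ (suc n) (suc k) ≡ chooseMinus₁ n k + chooseMinus₁ n (suc k)
chooseMinus₁-pascal n zero = refl
chooseMinus₁-pascal n (suc k) = refl

chooseMinus₂-pascal : ∀ n k → chooseMinus₂ (suc n) (suc k) ≡ chooseMinus₂ n k + chooseMinus₂ n (suc k)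
chooseMinus₂-pascal n zero = refl
chooseMinus₂-pascal n (suc k) = chooseMinus₁-pascal n k

choose-one : ∀ n → choose n 1 ≡ n
choose-one zero = refl
choose-one (suc n) = cong suc (choose-one n)

choose-absorption : ∀ n k → suc k * choose (suc n) (suc k) ≡ suc n * choose n k
choose-absorption n zero =
  trans (*-identityˡ _) (trans (choose-one (suc n)) (sym (*-identityʳ (suc n))))
choose-absorption zero (suc k) = *-zeroʳ (suc (suc k))
choose-absorption (suc n) (suc k) = begin
  suc (suc k) * (c₁ + c₂)
    ≡⟨ *-distribˡ-+ (suc (suc k)) c₁ c₂ ⟩
  suc (suc k) * c₁ + suc (suc k) * c₂
    ≡⟨ cong (suc (suc k) * c₁ +_) (choose-absorption n (suc k)) ⟩
  c₁ + suc k * c₁ + suc n * choose n (suc k)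
    ≡⟨ cong (λ t → c₁ + t + suc n * choose n (suc k)) (choose-absorption n k) ⟩
  c₁ + suc n * choose n k + suc n * choose n (suc k)
    ≡⟨ +-assoc c₁ _ _ ⟩
  c₁ + (suc n * choose n k + suc n * choose n (suc k))
    ≡⟨ cong (c₁ +_) (*-distribˡ-+ (suc n) (choose n k) (choose n (suc k))) ⟨
  suc (suc n) * choose (suc n) (suc k) ∎
  where
  open ≡-Reasoning
  c₁ = choose (suc n) (suc k)
  c₂ = choose (suc n) (suc (suc k))

chooseMinus₁-absorption : ∀ n k → k * choose (suc n) k ≡ suc n * chooseMinus₁ n k
chooseMinus₁-absorption n zero = sym (*-zeroʳ (suc n))
chooseMinus₁-absorption n (suc k) = choose-absorption n k

choose-codegree : ∀ N a → a ≤ N →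
  choose N a * chooseMinus₂ (N ∸ 2) a ≤ chooseMinus₁ (N ∸ 1) a * chooseMinus₁ (N ∸ 1) a
choose-codegree N zero _ = ≤-trans (≤-reflexive (*-zeroʳ (choose N 0))) z≤n
choose-codegree N (suc zero) _ = ≤-trans (≤-reflexive (*-zeroʳ (choose N 1))) z≤n
choose-codegree (suc (suc n)) (suc (suc k)) (s≤s (s≤s k≤n)) =
  *-cancelˡ-≤ (suc (suc k) * suc n) (begin
    suc (suc k) * suc n * (m * h₂)         ≡⟨ *-interchange (suc (suc k)) (suc n) m h₂ ⟩
    (suc (suc k) * m) * (suc n * h₂)       ≡⟨ cong₂ _*_ (choose-absorption (suc n) (suc k))
                                                         (sym (choose-absorption n k)) ⟩
    (suc (suc n) * h₁) * (suc k * h₁)      ≡⟨ *-interchange (suc (suc n)) h₁ (suc k) h₁ ⟩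
    suc (suc n) * suc k * (h₁ * h₁)        ≤⟨ *-monoˡ-≤ (h₁ * h₁) coefficients ⟩
    suc (suc k) * suc n * (h₁ * h₁)        ∎)
  where
  open ≤-Reasoning
  m = choose (suc (suc n)) (suc (suc k))
  h₁ = choose (suc n) (suc k)
  h₂ = choose n k
  split : ∀ a b → suc (suc a) * suc b ≡ suc b * suc a + suc b
  split = solve-∀
  coefficients : suc (suc n) * suc k ≤ suc (suc k) * suc n
  coefficients = begin
    suc (suc n) * suc k         ≡⟨ split n k ⟩
    suc k * suc n + suc k       ≤⟨ +-monoʳ-≤ (suc k * suc n) (s≤s k≤n) ⟩
    suc k * suc n + suc n       ≡⟨ cong (_+ suc n) (*-comm (suc k) (suc n)) ⟩
    suc n * suc k + suc n       ≡⟨ split k n ⟨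
    suc (suc k) * suc n         ∎

∑⊆ : ∀ n → ℕ → (Subset n → ℕ) → ℕ
∑⊆ n k = ∑ (subsetsOfSize n k)

∑⊆-suc : ∀ n k g → ∑⊆ (suc n) k g ≡
  ∑[ A ∈ allSubsets n ] (⟦ suc ∣ A ∣ ≡ᵇ k ⟧ * g (true ∷ A)) + ∑⊆ n k (g ∘ (false ∷_))
∑⊆-suc n k g = begin
  ∑⊆ (suc n) k g                                   ≡⟨ ∑-filter (λ A → ∣ A ∣ ≡ᵇ k) (allSubsets (suc n)) g ⟩
  ∑[ A ∈ allSubsets (suc n) ] (⟦ ∣ A ∣ ≡ᵇ k ⟧ * g A) ≡⟨ ∑-concatMap (allSubsets n) _ (λ A → ⟦ ∣ A ∣ ≡ᵇ k ⟧ * g A) ⟩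
  ∑[ A ∈ allSubsets n ] (with∈ A + (without∈ A + 0)) ≡⟨ ∑-cong (allSubsets n) (λ A → cong (with∈ A +_) (+-identityʳ _)) ⟩
  ∑[ A ∈ allSubsets n ] (with∈ A + without∈ A)       ≡⟨ ∑-+ (allSubsets n) with∈ without∈ ⟩
  ∑ (allSubsets n) with∈ + ∑ (allSubsets n) without∈
    ≡⟨ cong (∑ (allSubsets n) with∈ +_) (∑-filter (λ A → ∣ A ∣ ≡ᵇ k) (allSubsets n) (g ∘ (false ∷_))) ⟨
  ∑ (allSubsets n) with∈ + ∑⊆ n k (g ∘ (false ∷_)) ∎
  where
  open ≡-Reasoning
  with∈ without∈ : Subset n → ℕ
  with∈ A = ⟦ suc ∣ A ∣ ≡ᵇ k ⟧ * g (true ∷ A)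
  without∈ A = ⟦ ∣ A ∣ ≡ᵇ k ⟧ * g (false ∷ A)

∑⊆-suc-suc : ∀ n k g →
  ∑⊆ (suc n) (suc k) g ≡ ∑⊆ n k (g ∘ (true ∷_)) + ∑⊆ n (suc k) (g ∘ (false ∷_))
∑⊆-suc-suc n k g = trans (∑⊆-suc n (suc k) g) (cong (_+ ∑⊆ n (suc k) (g ∘ (false ∷_)))
  (sym (∑-filter (λ A → ∣ A ∣ ≡ᵇ k) (allSubsets n) (g ∘ (true ∷_)))))
∑⊆-suc-zero : ∀ n g → ∑⊆ (suc n) 0 g ≡ ∑⊆ n 0 (g ∘ (false ∷_))
∑⊆-suc-zero n g = trans (∑⊆-suc n 0 g) (cong (_+ ∑⊆ n 0 (g ∘ (false ∷_))) (∑-zero (allSubsets n)))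

∑⊆-zero : ∀ n k → ∑⊆ n k (λ _ → 0) ≡ 0
∑⊆-zero n k = ∑-zero (subsetsOfSize n k)

∑⊆-one : ∀ n k → ∑⊆ n k (λ _ → 1) ≡ choose n k
∑⊆-one zero zero = refl
∑⊆-one zero (suc k) = refl
∑⊆-one (suc n) zero = trans (∑⊆-suc-zero n _) (∑⊆-one n 0)
∑⊆-one (suc n) (suc k) = trans (∑⊆-suc-suc n k _) (cong₂ _+_ (∑⊆-one n k) (∑⊆-one n (suc k)))

length-subsetsOfSize : ∀ n k → length (subsetsOfSize n k) ≡ choose n k
length-subsetsOfSize n k = trans (sym (∑-one (subsetsOfSize n k))) (∑⊆-one n k)

∑⊆-member : ∀ n k (x : Fin (suc n)) → ∑⊆ (suc n) k (λ A → ⟦ lookup A x ⟧) ≡ chooseMinus₁ n k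
∑⊆-member n zero zero = trans (∑⊆-suc-zero n _) (∑⊆-zero n 0)
∑⊆-member (suc n) zero (suc x) = trans (∑⊆-suc-zero (suc n) _) (∑⊆-member n zero x)
∑⊆-member n (suc k) zero = begin
  ∑⊆ (suc n) (suc k) (λ A → ⟦ lookup A zero ⟧)  ≡⟨ ∑⊆-suc-suc n k _ ⟩
  ∑⊆ n k (λ _ → 1) + ∑⊆ n (suc k) (λ _ → 0) ≡⟨ cong₂ _+_ (∑⊆-one n k) (∑⊆-zero n (suc k)) ⟩
  choose n k + 0                              ≡⟨ +-identityʳ _ ⟩
  choose n k                                  ∎
  where open ≡-Reasoning
∑⊆-member (suc n) (suc k) (suc x) = begin
  ∑⊆ (suc (suc n)) (suc k) (λ A → ⟦ lookup A (suc x) ⟧)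
    ≡⟨ ∑⊆-suc-suc (suc n) k _ ⟩
  ∑⊆ (suc n) k (λ A → ⟦ lookup A x ⟧) + ∑⊆ (suc n) (suc k) (λ A → ⟦ lookup A x ⟧)
    ≡⟨ cong₂ _+_ (∑⊆-member n k x) (∑⊆-member n (suc k) x) ⟩
  chooseMinus₁ n k + chooseMinus₁ n (suc k)
    ≡⟨ chooseMinus₁-pascal n k ⟨
  chooseMinus₁ (suc n) (suc k) ∎
  where open ≡-Reasoning

∑⊆-pair-zero : ∀ n k (y : Fin (suc n)) →
  ∑⊆ (suc (suc n)) k (λ A → ⟦ lookup A zero ⟧ * ⟦ lookup A (suc y) ⟧) ≡ chooseMinus₂ n k
∑⊆-pair-zero n zero y = trans (∑⊆-suc-zero (suc n) _) (∑⊆-zero (suc n) 0)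
∑⊆-pair-zero n (suc k) y = begin
  ∑⊆ (suc (suc n)) (suc k) (λ A → ⟦ lookup A zero ⟧ * ⟦ lookup A (suc y) ⟧)
    ≡⟨ ∑⊆-suc-suc (suc n) k _ ⟩
  ∑⊆ (suc n) k (λ A → 1 * ⟦ lookup A y ⟧) + ∑⊆ (suc n) (suc k) (λ _ → 0)
    ≡⟨ cong₂ _+_ (∑-cong (subsetsOfSize (suc n) k) (λ A → *-identityˡ _)) (∑⊆-zero (suc n) (suc k)) ⟩
  ∑⊆ (suc n) k (λ A → ⟦ lookup A y ⟧) + 0
    ≡⟨ trans (+-identityʳ _) (∑⊆-member n k y) ⟩
  chooseMinus₁ n k ∎
  where open ≡-Reasoning

∑⊆-pair : ∀ n k (x y : Fin (suc (suc n))) → x ≢ y →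
  ∑⊆ (suc (suc n)) k (λ A → ⟦ lookup A x ⟧ * ⟦ lookup A y ⟧) ≡ chooseMinus₂ n k
∑⊆-pair n k zero zero x≢y = ⊥-elim (x≢y refl)
∑⊆-pair n k zero (suc y) _ = ∑⊆-pair-zero n k y
∑⊆-pair n k (suc x) zero _ =
  trans (∑-cong (subsetsOfSize (suc (suc n)) k) (λ A → *-comm ⟦ lookup A (suc x) ⟧ _))
        (∑⊆-pair-zero n k x)
∑⊆-pair zero k (suc zero) (suc zero) x≢y = ⊥-elim (x≢y refl)
∑⊆-pair (suc n) zero (suc x) (suc y) x≢y =
  trans (∑⊆-suc-zero (suc (suc n)) _) (∑⊆-pair n zero x y (x≢y ∘ cong suc))
∑⊆-pair (suc n) (suc k) (suc x) (suc y) x≢y = begin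
  ∑⊆ (suc (suc (suc n))) (suc k) (λ A → ⟦ lookup A (suc x) ⟧ * ⟦ lookup A (suc y) ⟧)
    ≡⟨ ∑⊆-suc-suc (suc (suc n)) k _ ⟩
  ∑⊆ (suc (suc n)) k (λ A → ⟦ lookup A x ⟧ * ⟦ lookup A y ⟧)
    + ∑⊆ (suc (suc n)) (suc k) (λ A → ⟦ lookup A x ⟧ * ⟦ lookup A y ⟧)
    ≡⟨ cong₂ _+_ (∑⊆-pair n k x y (x≢y ∘ cong suc)) (∑⊆-pair n (suc k) x y (x≢y ∘ cong suc)) ⟩
  chooseMinus₂ n k + chooseMinus₂ n (suc k)
    ≡⟨ chooseMinus₂-pascal n k ⟨
  chooseMinus₂ (suc n) (suc k) ∎
  where open ≡-Reasoning

∑⊆-pair≤ : ∀ n k (x y : Fin (suc n)) →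
  ∑⊆ (suc n) k (λ A → ⟦ lookup A x ⟧ * ⟦ lookup A y ⟧)
    ≤ chooseMinus₂ (n ∸ 1) k + δ x y * chooseMinus₁ n k
∑⊆-pair≤ n k x y with x Data.Fin.≟ y
... | yes refl = begin
  ∑⊆ (suc n) k (λ A → ⟦ lookup A x ⟧ * ⟦ lookup A x ⟧)
    ≡⟨ ∑-cong (subsetsOfSize (suc n) k) (λ A → ⟦⟧-idem (lookup A x)) ⟩
  ∑⊆ (suc n) k (λ A → ⟦ lookup A x ⟧)                 ≡⟨ ∑⊆-member n k x ⟩
  chooseMinus₁ n k                                    ≡⟨ +-identityʳ _ ⟨
  chooseMinus₁ n k + 0                                ≤⟨ m≤n+m _ (chooseMinus₂ (n ∸ 1) k) ⟩
  chooseMinus₂ (n ∸ 1) k + (chooseMinus₁ n k + 0)     ∎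
  where open ≤-Reasoning
... | no x≢y = ≤-reflexive (trans (pair n x y x≢y) (sym (+-identityʳ _)))
  where
  pair : ∀ n (x y : Fin (suc n)) → x ≢ y →
    ∑⊆ (suc n) k (λ A → ⟦ lookup A x ⟧ * ⟦ lookup A y ⟧) ≡ chooseMinus₂ (n ∸ 1) k
  pair zero zero zero x≢y = ⊥-elim (x≢y refl)
  pair (suc n) x y x≢y = ∑⊆-pair n k x y x≢y

-- The second moment method

private
  2*m*n≤m*m+n*n-ordered : ∀ {m n} → m ≤ n → 2 * m * n ≤ m * m + n * n
  2*m*n≤m*m+n*n-ordered {m} {n} m≤n = subst (λ n → 2 * m * n ≤ m * m + n * n) (m+[n∸m]≡n m≤n)
    (subst (2 * m * (m + d) ≤_) (sym (expand m d)) (m≤m+n _ (d * d)))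
    where
    d = n ∸ m
    expand : ∀ m d → m * m + (m + d) * (m + d) ≡ 2 * m * (m + d) + d * d
    expand = solve-∀

2*m*n≤m*m+n*n : ∀ m n → 2 * m * n ≤ m * m + n * n
2*m*n≤m*m+n*n m n with ≤-total m n
... | inj₁ m≤n = 2*m*n≤m*m+n*n-ordered m≤n
... | inj₂ n≤m = subst₂ _≤_ (swap n m) (+-comm (n * n) (m * m)) (2*m*n≤m*m+n*n-ordered n≤m)
  where
  swap : ∀ m n → 2 * m * n ≡ 2 * n * m
  swap = solve-∀

m≤m*m : ∀ m → m ≤ m * m
m≤m*m zero = z≤n
m≤m*m (suc m) = m≤m*n (suc m) (suc m)

-- Cauchy–Schwarz for X supported on p, via 2uvX ≤ u²⟦p⟧ + v²X² with u = ∑X², v = ∑X.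
∑-second-moment : ∀ {A : Set} (xs : List A) (p : A → Bool) (X : A → ℕ) →
  (∀ x → p x ≡ false → X x ≡ 0) →
  ∑ xs X * ∑ xs X ≤ ∑[ x ∈ xs ] ⟦ p x ⟧ * ∑[ x ∈ xs ] (X x * X x)
∑-second-moment xs p X X-support with ∑[ x ∈ xs ] (X x * X x) in Z≡
... | zero = ≤-trans (≤-reflexive (cong (λ y → y * y) Y≡0)) z≤n
  where
  Y≡0 : ∑ xs X ≡ 0
  Y≡0 = n≤0⇒n≡0 (subst (∑ xs X ≤_) Z≡ (∑-mono xs (λ x → m≤m*m (X x))))
... | Z@(suc _) = +-cancelʳ-≤ (Y * Y) (Y * Y) (K * Z) (*-cancelˡ-≤ Z (begin
  Z * (Y * Y + Y * Y)           ≡⟨ rearrange Z Y ⟩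
  2 * Z * Y * Y                 ≤⟨ weighted Z Y ⟩
  Z * Z * K + Y * Y * ∑[ x ∈ xs ] (X x * X x) ≡⟨ cong (λ z → Z * Z * K + Y * Y * z) Z≡ ⟩
  Z * Z * K + Y * Y * Z         ≡⟨ rearrange′ Z Y K ⟩
  Z * (K * Z + Y * Y)           ∎))
  where
  open ≤-Reasoning
  Y = ∑ xs X
  K = ∑[ x ∈ xs ] ⟦ p x ⟧
  rearrange : ∀ z y → z * (y * y + y * y) ≡ 2 * z * y * y
  rearrange = solve-∀
  rearrange′ : ∀ z y k → z * z * k + y * y * z ≡ z * (k * z + y * y)
  rearrange′ = solve-∀
  pointwise : ∀ u v x → 2 * u * v * X x ≤ u * u * ⟦ p x ⟧ + v * v * (X x * X x)
  pointwise u v x with p x in px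
  ... | true = subst₂ _≤_ (sym (assoc u v (X x))) (square u v (X x)) (2*m*n≤m*m+n*n u (v * X x))
    where
    assoc : ∀ u v x → 2 * u * v * x ≡ 2 * u * (v * x)
    assoc = solve-∀
    square : ∀ u v x → u * u + v * x * (v * x) ≡ u * u * 1 + v * v * (x * x)
    square = solve-∀
  ... | false rewrite X-support x px | *-zeroʳ (2 * u * v) = z≤n
  weighted : ∀ u v → 2 * u * v * Y ≤ u * u * K + v * v * ∑[ x ∈ xs ] (X x * X x)
  weighted u v = begin
    2 * u * v * Y ≡⟨ ∑-*ˡ xs (2 * u * v) X ⟨
    ∑[ x ∈ xs ] (2 * u * v * X x) ≤⟨ ∑-mono xs (pointwise u v) ⟩
    ∑[ x ∈ xs ] (u * u * ⟦ p x ⟧ + v * v * (X x * X x)) ≡⟨ ∑-linear xs (u * u) (v * v) _ _ ⟩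
    u * u * K + v * v * ∑[ x ∈ xs ] (X x * X x) ∎

paley-zygmund : ∀ M Y K Z → M ≤ Y → M * Z ≤ 4 * (Y * Y) → Y * Y ≤ K * Z → M ≤ 4 * K
paley-zygmund M zero K zero M≤0 _ _ = ≤-trans M≤0 z≤n
paley-zygmund M (suc y) K zero _ _ Y²≤K*0 = contradiction (≤-trans Y²≤K*0 (≤-reflexive (*-zeroʳ K))) λ ()
paley-zygmund M Y K Z@(suc _) _ MZ≤4Y² Y²≤KZ = *-cancelʳ-≤ M (4 * K) Z (begin
  M * Z           ≤⟨ MZ≤4Y² ⟩
  4 * (Y * Y)     ≤⟨ *-monoʳ-≤ 4 Y²≤KZ ⟩
  4 * (K * Z)     ≡⟨ *-assoc 4 K Z ⟨
  4 * K * Z       ∎)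
  where open ≤-Reasoning

scale-by-absorption : ∀ N a m d v w → 1 ≤ N → N * v ≤ w * a → a * m ≡ N * d → m * v ≤ w * d
scale-by-absorption N@(suc _) a m d v w _ Nv≤wa am≡Nd = *-cancelˡ-≤ N (begin
  N * (m * v)   ≡⟨ *-left-comm N m v ⟩
  m * (N * v)   ≤⟨ *-monoʳ-≤ m Nv≤wa ⟩
  m * (w * a)   ≡⟨ x*[y*z]≡y*[z*x] m w a ⟩
  w * (a * m)   ≡⟨ cong (w *_) am≡Nd ⟩
  w * (N * d)   ≡⟨ *-left-comm w N d ⟩
  N * (w * d)   ∎)
  where
  open ≤-Reasoning
  x*[y*z]≡y*[z*x] : ∀ x y z → x * (y * z) ≡ y * (z * x)
  x*[y*z]≡y*[z*x] = solve-∀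

choices-≤-first-moment : ∀ N a b t mᴬ mᴮ dᴬ dᴮ → 1 ≤ N → N * N ≤ t * (a * b) →
  a * mᴬ ≡ N * dᴬ → b * mᴮ ≡ N * dᴮ → mᴬ * mᴮ ≤ dᴬ * (dᴮ * t)
choices-≤-first-moment N@(suc _) a b t mᴬ mᴮ dᴬ dᴮ _ N²≤tab amᴬ≡Ndᴬ bmᴮ≡Ndᴮ = *-cancelˡ-≤ (N * N) (begin
  N * N * (mᴬ * mᴮ)               ≤⟨ *-monoˡ-≤ (mᴬ * mᴮ) N²≤tab ⟩
  t * (a * b) * (mᴬ * mᴮ)         ≡⟨ regroup t a b mᴬ mᴮ ⟩
  (a * mᴬ) * (b * mᴮ) * t         ≡⟨ cong₂ (λ u v → u * v * t) amᴬ≡Ndᴬ bmᴮ≡Ndᴮ ⟩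
  (N * dᴬ) * (N * dᴮ) * t         ≡⟨ regroup′ N dᴬ dᴮ t ⟩
  N * N * (dᴬ * (dᴮ * t))         ∎)
  where
  open ≤-Reasoning
  regroup : ∀ t a b m m′ → t * (a * b) * (m * m′) ≡ (a * m) * (b * m′) * t
  regroup = solve-∀
  regroup′ : ∀ N d d′ t → (N * d) * (N * d′) * t ≡ N * N * (d * (d′ * t))
  regroup′ = solve-∀

choices-*-second-moment : ∀ mᴬ mᴮ d₁ᴬ d₁ᴮ d₂ᴬ d₂ᴮ t vx vy →
  mᴬ * d₂ᴬ ≤ d₁ᴬ * d₁ᴬ → mᴮ * d₂ᴮ ≤ d₁ᴮ * d₁ᴮ →
  mᴬ * vx ≤ t * t * d₁ᴬ → mᴮ * vy ≤ t * t * d₁ᴮ →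
  mᴬ * mᴮ ≤ d₁ᴬ * (d₁ᴮ * t) →
  mᴬ * mᴮ * (d₂ᴬ * (d₂ᴮ * (t * t) + d₁ᴮ * vy) + d₁ᴬ * (d₂ᴮ * vx + d₁ᴮ * t))
    ≤ 4 * (d₁ᴬ * (d₁ᴮ * t) * (d₁ᴬ * (d₁ᴮ * t)))
choices-*-second-moment mᴬ mᴮ d₁ᴬ d₁ᴮ d₂ᴬ d₂ᴮ t vx vy hᴬ hᴮ vxᴬ vyᴮ M≤Y = begin
  mᴬ * mᴮ * (d₂ᴬ * (d₂ᴮ * (t * t) + d₁ᴮ * vy) + d₁ᴬ * (d₂ᴮ * vx + d₁ᴮ * t))
    ≡⟨ expand mᴬ mᴮ d₁ᴬ d₁ᴮ d₂ᴬ d₂ᴮ t vx vy ⟩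
  (mᴬ * d₂ᴬ) * ((mᴮ * d₂ᴮ) * (t * t)) + (mᴬ * d₂ᴬ) * (d₁ᴮ * (mᴮ * vy))
    + (mᴮ * d₂ᴮ) * (d₁ᴬ * (mᴬ * vx)) + (mᴬ * mᴮ) * (d₁ᴬ * (d₁ᴮ * t))
    ≤⟨ +-mono-≤ (+-mono-≤ (+-mono-≤
         (*-mono-≤ hᴬ (*-monoˡ-≤ (t * t) hᴮ))
         (*-mono-≤ hᴬ (*-monoʳ-≤ d₁ᴮ vyᴮ)))
         (*-mono-≤ hᴮ (*-monoʳ-≤ d₁ᴬ vxᴬ)))
         (*-monoˡ-≤ (d₁ᴬ * (d₁ᴮ * t)) M≤Y) ⟩
  (d₁ᴬ * d₁ᴬ) * ((d₁ᴮ * d₁ᴮ) * (t * t)) + (d₁ᴬ * d₁ᴬ) * (d₁ᴮ * (t * t * d₁ᴮ))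
    + (d₁ᴮ * d₁ᴮ) * (d₁ᴬ * (t * t * d₁ᴬ)) + d₁ᴬ * (d₁ᴮ * t) * (d₁ᴬ * (d₁ᴮ * t))
    ≡⟨ collect d₁ᴬ d₁ᴮ t ⟩
  4 * (d₁ᴬ * (d₁ᴮ * t) * (d₁ᴬ * (d₁ᴮ * t))) ∎
  where
  open ≤-Reasoning
  expand : ∀ mᴬ mᴮ d₁ᴬ d₁ᴮ d₂ᴬ d₂ᴮ t vx vy →
    mᴬ * mᴮ * (d₂ᴬ * (d₂ᴮ * (t * t) + d₁ᴮ * vy) + d₁ᴬ * (d₂ᴮ * vx + d₁ᴮ * t))
      ≡ (mᴬ * d₂ᴬ) * ((mᴮ * d₂ᴮ) * (t * t)) + (mᴬ * d₂ᴬ) * (d₁ᴮ * (mᴮ * vy))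
        + (mᴮ * d₂ᴮ) * (d₁ᴬ * (mᴬ * vx)) + (mᴬ * mᴮ) * (d₁ᴬ * (d₁ᴮ * t))
  expand = solve-∀
  collect : ∀ a b t →
    (a * a) * ((b * b) * (t * t)) + (a * a) * (b * (t * t * b))
      + (b * b) * (a * (t * t * a)) + a * (b * t) * (a * (b * t))
      ≡ 4 * (a * (b * t) * (a * (b * t)))
  collect = solve-∀

-- Rectangles meeting a relation

cells : ∀ N → List (Fin N × Fin N)
cells N = pairs (allFin N) (allFin N)

module _ {N : ℕ} (T : Rel2 N) where

  private
    t : Fin N × Fin N → ℕ
    t (x , y) = ⟦ T x y ⟧

  row col : Fin N → ℕ
  row x = count (T x)
  col y = count (λ x → T x y)

  hits : Subset N → Subset N → ℕ
  hits A B = ∑[ c ∈ cells N ] (⟦ lookup A (proj₁ c) ⟧ * (⟦ lookup B (proj₂ c) ⟧ * t c))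

  hits-meets : ∀ A B → meets T A B ≡ false → hits A B ≡ 0
  hits-meets A B disjoint = n≤0⇒n≡0 (begin
    hits A B
      ≡⟨ ∑-pairs (allFin N) (allFin N) _ ⟩
    ∑[ x < N ] ∑[ y < N ] (⟦ lookup A x ⟧ * (⟦ lookup B y ⟧ * ⟦ T x y ⟧))
      ≡⟨ ∑-cong (allFin N) (λ x → ∑-cong (allFin N) (λ y → sym (⟦∧∧⟧ (lookup A x) (lookup B y) (T x y)))) ⟩
    ∑[ x < N ] ∑[ y < N ] ⟦ hit x y ⟧
      ≤⟨ ∑-mono (allFin N) (λ x → ∑-≤-length (hit x) (allFin N)) ⟩
    ∑[ x < N ] (length (allFin N) * ⟦ any (hit x) (allFin N) ⟧)
      ≡⟨ ∑-*ˡ (allFin N) (length (allFin N)) _ ⟩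
    length (allFin N) * ∑[ x < N ] ⟦ any (hit x) (allFin N) ⟧
      ≤⟨ *-monoʳ-≤ (length (allFin N)) (∑-≤-length _ (allFin N)) ⟩
    length (allFin N) * (length (allFin N) * ⟦ meets T A B ⟧)
      ≡⟨ cong (λ b → length (allFin N) * (length (allFin N) * ⟦ b ⟧)) disjoint ⟩
    length (allFin N) * (length (allFin N) * 0)
      ≡⟨ trans (cong (length (allFin N) *_) (*-zeroʳ (length (allFin N)))) (*-zeroʳ (length (allFin N))) ⟩
    0 ∎)
    where
    open ≤-Reasoning
    hit : Fin N → Fin N → Bool
    hit x y = lookup A x ∧ lookup B y ∧ T x y
    ⟦∧∧⟧ : ∀ a b c → ⟦ a ∧ b ∧ c ⟧ ≡ ⟦ a ⟧ * (⟦ b ⟧ * ⟦ c ⟧)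
    ⟦∧∧⟧ a b c = trans (⟦∧⟧ a (b ∧ c)) (cong (⟦ a ⟧ *_) (⟦∧⟧ b c))

  card-cells : card T ≡ ∑ (cells N) t
  card-cells = sym (∑-pairs (allFin N) (allFin N) t)

  card²-cells : card T * card T ≡ ∑[ c ∈ cells N ] (t c * card T)
  card²-cells = trans (cong (_* card T) card-cells) (sym (∑-*ʳ (cells N) (card T) t))

  card-cells-squared : card T ≡ ∑[ c ∈ cells N ] (t c * t c)
  card-cells-squared = trans card-cells (∑-cong (cells N) (λ c → sym (⟦⟧-idem (T (proj₁ c) (proj₂ c)))))

  Vx-cells : Vx T ≡ ∑[ c ∈ cells N ] (t c * row (proj₁ c))
  Vx-cells = trans (∑-cong (allFin N) (λ x → sym (∑-*ʳ (allFin N) (row x) (λ y → ⟦ T x y ⟧))))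
                   (sym (∑-pairs (allFin N) (allFin N) (λ c → t c * row (proj₁ c))))

  Vy-cells : Vy T ≡ ∑[ c ∈ cells N ] (t c * col (proj₂ c))
  Vy-cells = begin
    Vy T
      ≡⟨ ∑-cong (allFin N) (λ y → sym (∑-*ʳ (allFin N) (col y) (λ x → ⟦ T x y ⟧))) ⟩
    ∑[ y < N ] ∑[ x < N ] (⟦ T x y ⟧ * col y)
      ≡⟨ ∑-comm (allFin N) (allFin N) _ ⟨
    ∑[ x < N ] ∑[ y < N ] (⟦ T x y ⟧ * col y)
      ≡⟨ ∑-pairs (allFin N) (allFin N) (λ c → t c * col (proj₂ c)) ⟨
    ∑[ c ∈ cells N ] (t c * col (proj₂ c)) ∎
    where open ≡-Reasoning

  ∑-cells-affine-δ : ∀ a b c d x y →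
    ∑[ e ∈ cells N ] ((a + δ x (proj₁ e) * b) * ((c + δ y (proj₂ e) * d) * t e))
      ≡ a * (c * card T + d * col y) + b * (c * row x + d * ⟦ T x y ⟧)
  ∑-cells-affine-δ a b c d x y = begin
    ∑[ e ∈ cells N ] ((a + δ x (proj₁ e) * b) * ((c + δ y (proj₂ e) * d) * t e))
      ≡⟨ ∑-pairs (allFin N) (allFin N) _ ⟩
    ∑[ x′ < N ] ∑[ y′ < N ] ((a + δ x x′ * b) * ((c + δ y y′ * d) * ⟦ T x′ y′ ⟧))
      ≡⟨ ∑-cong (allFin N) (λ x′ → ∑-*ˡ (allFin N) (a + δ x x′ * b) _) ⟩
    ∑[ x′ < N ] ((a + δ x x′ * b) * ∑[ y′ < N ] ((c + δ y y′ * d) * ⟦ T x′ y′ ⟧))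
      ≡⟨ ∑-cong (allFin N) (λ x′ → cong ((a + δ x x′ * b) *_) (∑<-affine-δ N c d y (λ y′ → ⟦ T x′ y′ ⟧))) ⟩
    ∑[ x′ < N ] ((a + δ x x′ * b) * (c * row x′ + d * ⟦ T x′ y ⟧))
      ≡⟨ ∑<-affine-δ N a b x (λ x′ → c * row x′ + d * ⟦ T x′ y ⟧) ⟩
    a * ∑[ x′ < N ] (c * row x′ + d * ⟦ T x′ y ⟧) + b * (c * row x + d * ⟦ T x y ⟧)
      ≡⟨ cong (λ s → a * s + b * (c * row x + d * ⟦ T x y ⟧)) (∑-linear (allFin N) c d row (λ x′ → ⟦ T x′ y ⟧)) ⟩
    a * (c * card T + d * col y) + b * (c * row x + d * ⟦ T x y ⟧) ∎
    where open ≡-Reasoning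

  private
    ∑-t*-linear : ∀ u v (f g : Fin N × Fin N → ℕ) →
      ∑[ e ∈ cells N ] (t e * (u * f e + v * g e))
        ≡ u * ∑[ e ∈ cells N ] (t e * f e) + v * ∑[ e ∈ cells N ] (t e * g e)
    ∑-t*-linear u v f g =
      trans (∑-cong (cells N) (λ e → distribute (t e) u (f e) v (g e))) (∑-linear (cells N) u v _ _)
      where
      distribute : ∀ t u f v g → t * (u * f + v * g) ≡ u * (t * f) + v * (t * g)
      distribute = solve-∀

  ∑∑-cells-affine-δ : ∀ a b c d →
    ∑[ e ∈ cells N ] ∑[ e′ ∈ cells N ]
      ((a + δ (proj₁ e) (proj₁ e′) * b) * ((c + δ (proj₂ e) (proj₂ e′) * d) * (t e * t e′)))
      ≡ a * (c * (card T * card T) + d * Vy T) + b * (c * Vx T + d * card T)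
  ∑∑-cells-affine-δ a b c d = begin
    ∑[ e ∈ cells N ] ∑[ e′ ∈ cells N ]
      ((a + δ (proj₁ e) (proj₁ e′) * b) * ((c + δ (proj₂ e) (proj₂ e′) * d) * (t e * t e′)))
      ≡⟨ ∑-cong (cells N) inner ⟩
    ∑[ e ∈ cells N ] (t e * (a * (c * card T + d * col (proj₂ e)) + b * (c * row (proj₁ e) + d * t e)))
      ≡⟨ ∑-t*-linear a b _ _ ⟩
    a * ∑[ e ∈ cells N ] (t e * (c * card T + d * col (proj₂ e)))
      + b * ∑[ e ∈ cells N ] (t e * (c * row (proj₁ e) + d * t e))
      ≡⟨ cong₂ (λ u v → a * u + b * v) (∑-t*-linear c d _ _) (∑-t*-linear c d _ _) ⟩
    a * (c * ∑[ e ∈ cells N ] (t e * card T) + d * ∑[ e ∈ cells N ] (t e * col (proj₂ e)))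
      + b * (c * ∑[ e ∈ cells N ] (t e * row (proj₁ e)) + d * ∑[ e ∈ cells N ] (t e * t e))
      ≡⟨ cong₂ (λ u v → a * u + b * v) (cong₂ (λ u v → c * u + d * v) card²-cells Vy-cells)
                                        (cong₂ (λ u v → c * u + d * v) Vx-cells card-cells-squared) ⟨
    a * (c * (card T * card T) + d * Vy T) + b * (c * Vx T + d * card T) ∎
    where
    open ≡-Reasoning
    pull-out : ∀ a b u v → a * (b * (u * v)) ≡ u * (a * (b * v))
    pull-out = solve-∀
    inner : ∀ e → ∑[ e′ ∈ cells N ]
                    ((a + δ (proj₁ e) (proj₁ e′) * b) * ((c + δ (proj₂ e) (proj₂ e′) * d) * (t e * t e′)))
                  ≡ t e * (a * (c * card T + d * col (proj₂ e)) + b * (c * row (proj₁ e) + d * t e))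
    inner e = trans (∑-cong (cells N) (λ e′ → pull-out (a + δ (proj₁ e) (proj₁ e′) * b)
                                                         (c + δ (proj₂ e) (proj₂ e′) * d) (t e) (t e′)))
                    (trans (∑-*ˡ (cells N) (t e) _)
                           (cong (t e *_) (∑-cells-affine-δ a b c d (proj₁ e) (proj₂ e))))

  module _ (LA LB : List (Subset N)) (d₁ᴬ d₂ᴬ d₁ᴮ d₂ᴮ : ℕ)
    (degreeᴬ : ∀ x → ∑[ A ∈ LA ] ⟦ lookup A x ⟧ ≡ d₁ᴬ)
    (codegreeᴬ : ∀ x x′ → ∑[ A ∈ LA ] (⟦ lookup A x ⟧ * ⟦ lookup A x′ ⟧) ≤ d₂ᴬ + δ x x′ * d₁ᴬ)
    (degreeᴮ : ∀ y → ∑[ B ∈ LB ] ⟦ lookup B y ⟧ ≡ d₁ᴮ)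
    (codegreeᴮ : ∀ y y′ → ∑[ B ∈ LB ] (⟦ lookup B y ⟧ * ⟦ lookup B y′ ⟧) ≤ d₂ᴮ + δ y y′ * d₁ᴮ)
    where

    ∑-hits : ∑[ A ∈ LA ] ∑[ B ∈ LB ] hits A B ≡ d₁ᴬ * (d₁ᴮ * card T)
    ∑-hits = begin
      ∑[ A ∈ LA ] ∑[ B ∈ LB ] hits A B
        ≡⟨ ∑∑-comm-∑ LA LB (cells N) _ ⟩
      ∑[ e ∈ cells N ] ∑[ A ∈ LA ] ∑[ B ∈ LB ] (A∋ e A * (B∋ e B * t e))
        ≡⟨ ∑-cong (cells N) (λ e → ∑∑-separate LA LB (A∋ e) (B∋ e) (t e)) ⟩
      ∑[ e ∈ cells N ] (∑ LA (A∋ e) * (∑ LB (B∋ e) * t e))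
        ≡⟨ ∑-cong (cells N) (λ e → cong₂ (λ u v → u * (v * t e)) (degreeᴬ (proj₁ e)) (degreeᴮ (proj₂ e))) ⟩
      ∑[ e ∈ cells N ] (d₁ᴬ * (d₁ᴮ * t e))
        ≡⟨ trans (∑-*ˡ (cells N) d₁ᴬ _) (cong (d₁ᴬ *_) (∑-*ˡ (cells N) d₁ᴮ t)) ⟩
      d₁ᴬ * (d₁ᴮ * ∑ (cells N) t)
        ≡⟨ cong (λ s → d₁ᴬ * (d₁ᴮ * s)) card-cells ⟨
      d₁ᴬ * (d₁ᴮ * card T) ∎
      where
      open ≡-Reasoning
      A∋ B∋ : Fin N × Fin N → Subset N → ℕ
      A∋ e A = ⟦ lookup A (proj₁ e) ⟧
      B∋ e B = ⟦ lookup B (proj₂ e) ⟧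

    ∑-hits² : ∑[ A ∈ LA ] ∑[ B ∈ LB ] (hits A B * hits A B)
              ≤ d₂ᴬ * (d₂ᴮ * (card T * card T) + d₁ᴮ * Vy T) + d₁ᴬ * (d₂ᴮ * Vx T + d₁ᴮ * card T)
    ∑-hits² = begin
      ∑[ A ∈ LA ] ∑[ B ∈ LB ] (hits A B * hits A B)
        ≡⟨ ∑-cong LA (λ A → ∑-cong LB (hits²-cells A)) ⟩
      ∑[ A ∈ LA ] ∑[ B ∈ LB ] ∑[ e ∈ cells N ] ∑[ e′ ∈ cells N ] term A B e e′
        ≡⟨ ∑∑-comm-∑ LA LB (cells N) _ ⟩
      ∑[ e ∈ cells N ] ∑[ A ∈ LA ] ∑[ B ∈ LB ] ∑[ e′ ∈ cells N ] term A B e e′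
        ≡⟨ ∑-cong (cells N) (λ e → ∑∑-comm-∑ LA LB (cells N) (λ A B → term A B e)) ⟩
      ∑[ e ∈ cells N ] ∑[ e′ ∈ cells N ] ∑[ A ∈ LA ] ∑[ B ∈ LB ] term A B e e′
        ≡⟨ ∑-cong (cells N) (λ e → ∑-cong (cells N) (λ e′ →
             ∑∑-separate LA LB (λ A → A∋ e A * A∋ e′ A) (λ B → B∋ e B * B∋ e′ B) (t e * t e′))) ⟩
      ∑[ e ∈ cells N ] ∑[ e′ ∈ cells N ]
        (∑[ A ∈ LA ] (A∋ e A * A∋ e′ A) * (∑[ B ∈ LB ] (B∋ e B * B∋ e′ B) * (t e * t e′)))
        ≤⟨ ∑-mono (cells N) (λ e → ∑-mono (cells N) (λ e′ →
             *-mono-≤ (codegreeᴬ (proj₁ e) (proj₁ e′)) (*-monoˡ-≤ (t e * t e′) (codegreeᴮ (proj₂ e) (proj₂ e′))))) ⟩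
      ∑[ e ∈ cells N ] ∑[ e′ ∈ cells N ]
        ((d₂ᴬ + δ (proj₁ e) (proj₁ e′) * d₁ᴬ) * ((d₂ᴮ + δ (proj₂ e) (proj₂ e′) * d₁ᴮ) * (t e * t e′)))
        ≡⟨ ∑∑-cells-affine-δ d₂ᴬ d₁ᴬ d₂ᴮ d₁ᴮ ⟩
      d₂ᴬ * (d₂ᴮ * (card T * card T) + d₁ᴮ * Vy T) + d₁ᴬ * (d₂ᴮ * Vx T + d₁ᴮ * card T) ∎
      where
      open ≤-Reasoning
      A∋ B∋ : Fin N × Fin N → Subset N → ℕ
      A∋ e A = ⟦ lookup A (proj₁ e) ⟧
      B∋ e B = ⟦ lookup B (proj₂ e) ⟧
      term : Subset N → Subset N → Fin N × Fin N → Fin N × Fin N → ℕ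
      term A B e e′ = (A∋ e A * A∋ e′ A) * ((B∋ e B * B∋ e′ B) * (t e * t e′))
      interchange : ∀ a b u a′ b′ u′ → (a * (b * u)) * (a′ * (b′ * u′)) ≡ (a * a′) * ((b * b′) * (u * u′))
      interchange = solve-∀
      hits²-cells : ∀ A B → hits A B * hits A B ≡ ∑[ e ∈ cells N ] ∑[ e′ ∈ cells N ] term A B e e′
      hits²-cells A B = trans (∑-*-∑ (cells N) (cells N) _ _) (∑-cong (cells N) (λ e → ∑-cong (cells N) (λ e′ →
        interchange (A∋ e A) (B∋ e B) (t e) (A∋ e′ A) (B∋ e′ B) (t e′))))

random-rectangle-meets : ∀ N (T : Rel2 N) a b → 1 ≤ N → a ≤ N → b ≤ N →
  N * Vx T ≤ card T * card T * a → N * Vy T ≤ card T * card T * b → N * N ≤ card T * (a * b) →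
  length (subsetsOfSize N a) * length (subsetsOfSize N b)
    ≤ 4 * countL (λ p → meets T (proj₁ p) (proj₂ p)) (pairs (subsetsOfSize N a) (subsetsOfSize N b))
random-rectangle-meets N@(suc n) T a b 1≤N a≤N b≤N Vx-bound Vy-bound N²-bound =
  subst (_≤ 4 * K) (sym (cong₂ _*_ (length-subsetsOfSize N a) (length-subsetsOfSize N b)))
    (paley-zygmund M Y K Z M≤Y MZ≤4Y² Y²≤KZ)
  where
  LA = subsetsOfSize N a
  LB = subsetsOfSize N b
  rectangles = pairs LA LB
  hits′ : Subset N × Subset N → ℕ
  hits′ p = hits T (proj₁ p) (proj₂ p)
  K = countL (λ p → meets T (proj₁ p) (proj₂ p)) rectangles
  Y = ∑ rectangles hits′
  Z = ∑[ p ∈ rectangles ] (hits′ p * hits′ p)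
  M = choose N a * choose N b
  d₁ᴬ = chooseMinus₁ n a
  d₁ᴮ = chooseMinus₁ n b
  d₂ᴬ = chooseMinus₂ (n ∸ 1) a
  d₂ᴮ = chooseMinus₂ (n ∸ 1) b
  Y≡ : Y ≡ d₁ᴬ * (d₁ᴮ * card T)
  Y≡ = trans (∑-pairs LA LB hits′) (∑-hits T LA LB d₁ᴬ d₂ᴬ d₁ᴮ d₂ᴮ
    (∑⊆-member n a) (∑⊆-pair≤ n a) (∑⊆-member n b) (∑⊆-pair≤ n b))
  Z≤ : Z ≤ d₂ᴬ * (d₂ᴮ * (card T * card T) + d₁ᴮ * Vy T) + d₁ᴬ * (d₂ᴮ * Vx T + d₁ᴮ * card T)
  Z≤ = ≤-trans (≤-reflexive (∑-pairs LA LB (λ p → hits′ p * hits′ p))) (∑-hits² T LA LB d₁ᴬ d₂ᴬ d₁ᴮ d₂ᴮ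
    (∑⊆-member n a) (∑⊆-pair≤ n a) (∑⊆-member n b) (∑⊆-pair≤ n b))
  Y²≤KZ : Y * Y ≤ K * Z
  Y²≤KZ = ∑-second-moment rectangles (λ p → meets T (proj₁ p) (proj₂ p)) hits′
            (λ p → hits-meets T (proj₁ p) (proj₂ p))
  M≤Y : M ≤ Y
  M≤Y = subst (M ≤_) (sym Y≡) (choices-≤-first-moment N a b (card T) _ _ d₁ᴬ d₁ᴮ 1≤N N²-bound
          (chooseMinus₁-absorption n a) (chooseMinus₁-absorption n b))
  MZ≤4Y² : M * Z ≤ 4 * (Y * Y)
  MZ≤4Y² = subst (λ y → M * Z ≤ 4 * (y * y)) (sym Y≡) (≤-trans (*-monoʳ-≤ M Z≤)
    (choices-*-second-moment (choose N a) (choose N b) d₁ᴬ d₁ᴮ d₂ᴬ d₂ᴮ (card T) (Vx T) (Vy T)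
      (choose-codegree N a a≤N) (choose-codegree N b b≤N)
      (scale-by-absorption N a (choose N a) d₁ᴬ (Vx T) (card T * card T) 1≤N Vx-bound (chooseMinus₁-absorption n a))
      (scale-by-absorption N b (choose N b) d₁ᴮ (Vy T) (card T * card T) 1≤N Vy-bound (chooseMinus₁-absorption n b))
      (subst (M ≤_) Y≡ M≤Y)))

-- Tensor powers

module _ {q : ℕ} (S : Rel2 q) where

  tensorPow-suc : ∀ c i r j r′ →
    tensorPow S (suc c) (combine {q} {q ^ c} i r) (combine j r′) ≡ (S i j ∧ tensorPow S c r r′)
  tensorPow-suc c i r j r′ = begin
    tensorPow S (suc c) x y
      ≡⟨ cong (S (proj₁ (remQuot {q} (q ^ c) x)) (proj₁ (remQuot {q} (q ^ c) y)) ∧_)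
              (trans (cong and (map-tabulate suc digit)) (cong and (sym (map-tabulate id (digit ∘ suc))))) ⟩
    S (proj₁ (remQuot {q} (q ^ c) x)) (proj₁ (remQuot {q} (q ^ c) y))
      ∧ tensorPow S c (proj₂ (remQuot {q} (q ^ c) x)) (proj₂ (remQuot {q} (q ^ c) y))
      ≡⟨ cong₂ (λ u v → S (proj₁ u) (proj₁ v) ∧ tensorPow S c (proj₂ u) (proj₂ v))
               (remQuot-combine i r) (remQuot-combine j r′) ⟩
    S i j ∧ tensorPow S c r r′ ∎
    where
    open ≡-Reasoning
    x = combine {q} {q ^ c} i r
    y = combine {q} {q ^ c} j r′
    digit : Fin (suc c) → _
    digit l = S (decode (suc c) x l) (decode (suc c) y l)

  row-tensorPow-suc : ∀ c i r → row (tensorPow S (suc c)) (combine {q} {q ^ c} i r) ≡ row S i * row (tensorPow S c) r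
  row-tensorPow-suc c i r = ∑<-combine-* q (q ^ c) _ (λ j → ⟦ S i j ⟧) (λ r′ → ⟦ tensorPow S c r r′ ⟧)
    (λ j r′ → trans (cong ⟦_⟧ (tensorPow-suc c i r j r′)) (⟦∧⟧ (S i j) _))

  col-tensorPow-suc : ∀ c j r′ → col (tensorPow S (suc c)) (combine {q} {q ^ c} j r′) ≡ col S j * col (tensorPow S c) r′
  col-tensorPow-suc c j r′ = ∑<-combine-* q (q ^ c) _ (λ i → ⟦ S i j ⟧) (λ r → ⟦ tensorPow S c r r′ ⟧)
    (λ i r → trans (cong ⟦_⟧ (tensorPow-suc c i r j r′)) (⟦∧⟧ (S i j) _))

  private
    [x*y]*[x*y] : ∀ x y → (x * y) * (x * y) ≡ (x * x) * (y * y)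
    [x*y]*[x*y] = solve-∀

  card-tensorPow : ∀ c → card (tensorPow S c) ≡ card S ^ c
  card-tensorPow zero = refl
  card-tensorPow (suc c) =
    trans (∑<-combine-* q (q ^ c) _ (row S) (row (tensorPow S c)) (row-tensorPow-suc c))
          (cong (card S *_) (card-tensorPow c))

  Vx-tensorPow : ∀ c → Vx (tensorPow S c) ≡ Vx S ^ c
  Vx-tensorPow zero = refl
  Vx-tensorPow (suc c) =
    trans (∑<-combine-* q (q ^ c) _ (λ i → row S i * row S i) (λ r → row (tensorPow S c) r * row (tensorPow S c) r)
             (λ i r → trans (cong (λ n → n * n) (row-tensorPow-suc c i r)) ([x*y]*[x*y] (row S i) _)))
          (cong (Vx S *_) (Vx-tensorPow c))

  Vy-tensorPow : ∀ c → Vy (tensorPow S c) ≡ Vy S ^ c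
  Vy-tensorPow zero = refl
  Vy-tensorPow (suc c) =
    trans (∑<-combine-* q (q ^ c) _ (λ j → col S j * col S j) (λ r → col (tensorPow S c) r * col (tensorPow S c) r)
             (λ j r → trans (cong (λ n → n * n) (col-tensorPow-suc c j r)) ([x*y]*[x*y] (col S j) _)))
          (cong (Vy S *_) (Vy-tensorPow c))

-- Translating the hypotheses

^2 : ∀ m → m ^ 2 ≡ m * m
^2 m = cong (m *_) (*-identityʳ m)

^3 : ∀ m → m ^ 3 ≡ m * m * m
^3 m = trans (cong (m *_) (^2 m)) (sym (*-assoc m m m))

^-2* : ∀ m c → m ^ (2 * c) ≡ m ^ c * m ^ c
^-2* m c = trans (cong (m ^_) (cong (c +_) (+-identityʳ c))) (^-distribˡ-+-* m c c)

*-cancel-square : ∀ m n → m * m ≤ n * n → m ≤ n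
*-cancel-square m n m²≤n² with m ≤? n
... | yes m≤n = m≤n
... | no m≰n = contradiction m²≤n² (<⇒≱ (*-mono-< n<m n<m))
  where n<m = ≰⇒> m≰n

^-distribʳ-* : ∀ m n c → (m * n) ^ c ≡ m ^ c * n ^ c
^-distribʳ-* m n zero = refl
^-distribʳ-* m n (suc c) = trans (cong (m * n *_) (^-distribʳ-* m n c)) (*-interchange m n (m ^ c) (n ^ c))

^-square≤cube : ∀ c {v s} → v * v ≤ s * s * s → v ^ c * v ^ c ≤ s ^ c * s ^ c * s ^ c
^-square≤cube c {v} {s} v²≤s³ = begin
  v ^ c * v ^ c                 ≡⟨ ^-distribʳ-* v v c ⟨
  (v * v) ^ c                   ≤⟨ ^-monoˡ-≤ c v²≤s³ ⟩
  (s * s * s) ^ c               ≡⟨ trans (^-distribʳ-* (s * s) s c) (cong (_* s ^ c) (^-distribʳ-* s s c)) ⟩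
  s ^ c * s ^ c * s ^ c         ∎
  where open ≤-Reasoning

n*v≤s*s*a : ∀ n s v a → n * n ≤ a * a * s → v * v ≤ s * s * s → n * v ≤ s * s * a
n*v≤s*s*a n s v a n²≤a²s v²≤s³ = *-cancel-square _ _ (begin
  n * v * (n * v)         ≡⟨ *-interchange n v n v ⟩
  n * n * (v * v)         ≤⟨ *-mono-≤ n²≤a²s v²≤s³ ⟩
  a * a * s * (s * s * s) ≡⟨ regroup a s ⟩
  s * s * a * (s * s * a) ∎)
  where
  open ≤-Reasoning
  regroup : ∀ a s → a * a * s * (s * s * s) ≡ s * s * a * (s * s * a)
  regroup = solve-∀

n*n≤s*[a*b] : ∀ n s a b → n * n ≤ a * a * s → n * n ≤ b * b * s → n * n ≤ s * (a * b)
n*n≤s*[a*b] n s a b n²≤a²s n²≤b²s = *-cancel-square _ _ (begin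
  n * n * (n * n)          ≤⟨ *-mono-≤ n²≤a²s n²≤b²s ⟩
  a * a * s * (b * b * s)  ≡⟨ regroup a b s ⟩
  s * (a * b) * (s * (a * b)) ∎)
  where
  open ≤-Reasoning
  regroup : ∀ a b s → a * a * s * (b * b * s) ≡ s * (a * b) * (s * (a * b))
  regroup = solve-∀

lemma3p7 : (q : ℕ) → 1 ≤ q → (S : Rel2 q) → 0 < card S
         → (Vx S + Vy S) ^ 2 ≤ card S ^ 3
         → (c : ℕ) → 1 ≤ c → (a b : ℕ) → a ≤ q ^ c → b ≤ q ^ c
         → q ^ (2 * c) ≤ a ^ 2 * card S ^ c
         → q ^ (2 * c) ≤ b ^ 2 * card S ^ c
         → length (subsetsOfSize (q ^ c) a) * length (subsetsOfSize (q ^ c) b)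
           ≤ 4 * countL (λ p → meets (tensorPow S c) (proj₁ p) (proj₂ p))
                        (pairs (subsetsOfSize (q ^ c) a) (subsetsOfSize (q ^ c) b))
lemma3p7 q@(suc _) _ S _ V²≤s³ c _ a b a≤N b≤N q²ᶜ≤a²σ q²ᶜ≤b²σ =
  random-rectangle-meets N T a b (m^n>0 q c) a≤N b≤N
    (subst₂ (λ v t → N * v ≤ t * t * a) (sym (Vx-tensorPow S c)) (sym (card-tensorPow S c))
      (n*v≤s*s*a N σ (Vx S ^ c) a N²≤a²σ (^-square≤cube c Vx²≤s³)))
    (subst₂ (λ v t → N * v ≤ t * t * b) (sym (Vy-tensorPow S c)) (sym (card-tensorPow S c))
      (n*v≤s*s*a N σ (Vy S ^ c) b N²≤b²σ (^-square≤cube c Vy²≤s³)))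
    (subst (λ t → N * N ≤ t * (a * b)) (sym (card-tensorPow S c)) (n*n≤s*[a*b] N σ a b N²≤a²σ N²≤b²σ))
  where
  N = q ^ c
  T = tensorPow S c
  s = card S
  σ = s ^ c
  N²≤a²σ : N * N ≤ a * a * σ
  N²≤a²σ = subst₂ _≤_ (^-2* q c) (cong (_* σ) (^2 a)) q²ᶜ≤a²σ
  N²≤b²σ : N * N ≤ b * b * σ
  N²≤b²σ = subst₂ _≤_ (^-2* q c) (cong (_* σ) (^2 b)) q²ᶜ≤b²σ
  V²≤s*s*s : (Vx S + Vy S) * (Vx S + Vy S) ≤ s * s * s
  V²≤s*s*s = subst₂ _≤_ (^2 (Vx S + Vy S)) (^3 s) V²≤s³
  Vx²≤s³ : Vx S * Vx S ≤ s * s * s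
  Vx²≤s³ = ≤-trans (*-mono-≤ (m≤m+n (Vx S) (Vy S)) (m≤m+n (Vx S) (Vy S))) V²≤s*s*s
  Vy²≤s³ : Vy S * Vy S ≤ s * s * s
  Vy²≤s³ = ≤-trans (*-mono-≤ (m≤n+m (Vy S) (Vx S)) (m≤n+m (Vy S) (Vx S))) V²≤s*s*s
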